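{- Let $\mathcal{C}$ be an $n$-step staircase and let $x_{\max},y_{\max},z_{\max}$ be the maximum $x$-, $y$-, $z$-coordinates of points of $\mathcal{C}$. Let $\mathcal{H}_Z$ be the sequence returned by the boundary tracing algorithm with search order $(x,y,z)$ started at some point $(x,y,z_{\max})\in\mathcal{C}$; let $\mathcal{H}_X$ be the sequence returned with search order $(y,z,x)$ started at some point $(x_{\max},y,z)\in\mathcal{C}$; and let $\mathcal{H}_Y$ be the sequence returned with search order $(z,x,y)$ started at some point $(x,y_{\max},z)\in\mathcal{C}$. Then $\mathcal{C}=\mathcal{H}_X\vee\mathcal{H}_Y\vee\mathcal{H}_Z:=\{A_1\cup A_2\cup A_3: A_1\in\mathcal{H}_X,\ A_2\in\mathcal{H}_Y,\ A_3\in\mathcal{H}_Z\}$.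
   Context: Points of $\mathbb{Z}^3$ are regarded as multisets over $\{x,y,z\}$; $A\cup B$ is the coordinatewise maximum. A digital cuboid is a set $C=\{(x,y,z)\in\mathbb{Z}^3: x_{\min}\le x\le x_{\max},\ y_{\min}\le y\le y_{\max},\ z_{\min}\le z\le z_{\max}\}$ with $|C|>1$. A sequence of cuboids $C_1,\dots,C_n$ (with parameters $x^i_{\min},x^i_{\max}$, etc.) is regular if (a) $x^1_{\min}=y^1_{\min}=z^1_{\min}=0$; (b) for each $1\le i\le n-1$: $x^i_{\min}\le x^{i+1}_{\min}$, $y^i_{\min}\le y^{i+1}_{\min}$, $z^i_{\min}\le z^{i+1}_{\min}$, at least one strict; (c) for each $1\le i\le n-1$: $x^{i+1}_{\min}\le x^i_{\max}$, $y^{i+1}_{\min}\le y^i_{\max}$, $z^{i+1}_{\min}\le z^i_{\max}$; (d) for each $1\le i\le n-1$: $x^i_{\max}\le x^{i+1}_{\max}$, $y^i_{\max}\le y^{i+1}_{\max}$, $z^i_{\max}\le z^{i+1}_{\max}$, at least one strict. The union $\mathcal{C}=C_1\cup\dots\cup C_n$ of a regular sequence is an $n$-step staircase. Boundary tracing algorithm with search order $(u,v,w)$ (a permutation of the coordinates $x,y,z$) started at a point $P\in\mathcal{C}$: set the current point to $P$ and record it as $B_0$; repeat: if decreasing coordinate $u$ by $1$ gives a point of $\mathcal{C}$, decrease $u$; else if decreasing $v$ by $1$ gives a point of $\mathcal{C}$, decrease $v$; else decrease $w$ by $1$; record the new point as $B_{i}$ (with $i$ incremented); stop when $B_i=(0,0,0)$.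 The output is the sequence $B_i,B_{i-1},\dots,B_0$. -}

module Defs where

open import Data.Integer using (ℤ; _≤_; _<_; _⊔_; _-_; 0ℤ; 1ℤ)
open import Data.Product using (_×_; _,_; Σ; ∃; ∃-syntax)
open import Data.Sum using (_⊎_)
open import Data.List using (List; []; _∷_; reverse)
open import Data.List.Relation.Unary.All using (All)
open import Data.List.Relation.Unary.Any using (Any)
open import Data.List.Relation.Unary.Linked using (Linked)
open import Data.List.Membership.Propositional using (_∈_)
open import Relation.Binary.PropositionalEquality using (_≡_; _≢_)
open import Relation.Nullary using (¬_)

Point : Set
Point = ℤ × ℤ × ℤ

px py pz : Point → ℤ
px (a , _ , _) = a
py (_ , b , _) = b
pz (_ , _ , c) = c

origin : Point
origin = 0ℤ , 0ℤ , 0ℤ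

-- union of points regarded as multisets = coordinatewise maximum
_∪ₚ_ : Point → Point → Point
(a , b , c) ∪ₚ (a' , b' , c') = (a ⊔ a') , (b ⊔ b') , (c ⊔ c')

record Box : Set where
  constructor box
  field
    xmin xmax ymin ymax zmin zmax : ℤ
open Box public

_∈Box_ : Point → Box → Set
(a , b , c) ∈Box B =
  (xmin B ≤ a × a ≤ xmax B) × (ymin B ≤ b × b ≤ ymax B) × (zmin B ≤ c × c ≤ zmax B)

-- |C| > 1 : the cuboid contains two distinct points
IsCuboid : Box → Set
IsCuboid B = ∃[ P ] ∃[ Q ] (P ∈Box B × Q ∈Box B × P ≢ Q)

Consecutive : Box → Box → Set
Consecutive C D =
  ((xmin C ≤ xmin D × ymin C ≤ ymin D × zmin C ≤ zmin D)
    × (xmin C < xmin D ⊎ ymin C < ymin D ⊎ zmin C < zmin D))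
  × (xmin D ≤ xmax C × ymin D ≤ ymax C × zmin D ≤ zmax C)
  × ((xmax C ≤ xmax D × ymax C ≤ ymax D × zmax C ≤ zmax D)
    × (xmax C < xmax D ⊎ ymax C < ymax D ⊎ zmax C < zmax D))

Regular : Box → List Box → Set
Regular C₁ rest =
  All IsCuboid (C₁ ∷ rest)
  × (xmin C₁ ≡ 0ℤ × ymin C₁ ≡ 0ℤ × zmin C₁ ≡ 0ℤ)
  × Linked Consecutive (C₁ ∷ rest)

_∈St_ : Point → List Box → Set
P ∈St Cs = Any (P ∈Box_) Cs

data Coord : Set where
  cx cy cz : Coord

dec : Coord → Point → Point
dec cx (a , b , c) = (a - 1ℤ) , b , c
dec cy (a , b , c) = a , (b - 1ℤ) , c
dec cz (a , b , c) = a , b , (c - 1ℤ)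

data Step (Cs : List Box) (u v w : Coord) (Q : Point) : Point → Set where
  step-u : dec u Q ∈St Cs → Step Cs u v w Q (dec u Q)
  step-v : ¬ (dec u Q ∈St Cs) → dec v Q ∈St Cs → Step Cs u v w Q (dec v Q)
  step-w : ¬ (dec u Q ∈St Cs) → ¬ (dec v Q ∈St Cs) → Step Cs u v w Q (dec w Q)

-- Run Cs u v w Q L : running the algorithm from current point Q records
-- the points L = Q , ... , (0,0,0) (in order of visit) and then stops.
data Run (Cs : List Box) (u v w : Coord) : Point → List Point → Set where
  stop : Run Cs u v w origin (origin ∷ [])
  next : ∀ {Q Q' L} → Q ≢ origin → Step Cs u v w Q Q' → Run Cs u v w Q' L →
         Run Cs u v w Q (Q ∷ L)

-- Traced Cs u v w P H : H is the output sequence Bᵢ, ..., B₀ of the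
-- algorithm with search order (u,v,w) started at P.
Traced : List Box → Coord → Coord → Coord → Point → List Point → Set
Traced Cs u v w P H = ∃[ L ] (Run Cs u v w P L × H ≡ reverse L)

MaxIn : (Point → ℤ) → List Box → Point → Set
MaxIn f Cs P = P ∈St Cs × (∀ Q → Q ∈St Cs → f Q ≤ f P)

_∈Join[_,_,_] : Point → List Point → List Point → List Point → Set
P ∈Join[ Hx , Hy , Hz ] =
  ∃[ A₁ ] ∃[ A₂ ] ∃[ A₃ ] (A₁ ∈ Hx × A₂ ∈ Hy × A₃ ∈ Hz × P ≡ (A₁ ∪ₚ A₂) ∪ₚ A₃)

module Submission where

-- A staircase is the union of a chain of boxes whose lower and upper corners both increase, so
-- it is closed under coordinatewise maximum, and every point other than the lowest corner (the
-- origin) can step down in some coordinate without leaving it.  For the search order (u,v,w),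
-- the tracer therefore only decreases w at points that cannot descend in u or v ("stuck"
-- points), and it visits a stuck point on every w-level between 0 and its start.  A stuck point
-- lies on the lower face of a box and is the coordinatewise least point of its w-slice of the
-- staircase.  So for P in the staircase, the three traces contain points A₁, A₂, A₃ below P
-- that agree with P in x, y, z respectively, and P = A₁ ∪ A₂ ∪ A₃.  Conversely every traced
-- point lies in the staircase, and the staircase is closed under ∪.

open import Defs
open import Data.List using (List; _∷_)
open import Data.Product using (_×_; _,_; proj₁; proj₂; ∃-syntax)
open import Data.Sum using (_⊎_; inj₁; inj₂)
open import Data.Integer using (ℤ; _≤_; _<_; _⊔_; _-_; 0ℤ; 1ℤ; -1ℤ)
open import Data.Integer.Properties
  using (≤-trans; ≤-reflexive; ≤-refl; ≤-antisym; _<?_; ≮⇒≥; ≤∧≢⇒<; <-irrefl;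
         i<j⇒i≤pred[j]; i≤j⇒i-k≤j; +-comm; ⊔-comm; ⊔-lub; i≤i⊔j; i≤j⊔i)
  renaming (_≟_ to _≟ℤ_)
open import Data.List.Relation.Unary.Any using (here; there)
open import Data.List.Relation.Unary.Any.Properties using (reverse⁺; reverse⁻)
open import Data.List.Relation.Unary.Linked using (Linked; _∷_)
open import Data.List.Membership.Propositional using (_∈_)
open import Relation.Binary.PropositionalEquality
  using (_≡_; _≢_; refl; sym; trans; cong; cong₂; subst)
open import Relation.Nullary using (¬_; yes; no; contradiction)

i<j⇒i≤j-1 : ∀ {i j} → i < j → i ≤ j - 1ℤ
i<j⇒i≤j-1 {i} {j} i<j = subst (i ≤_) (+-comm -1ℤ j) (i<j⇒i≤pred[j] i<j)

i-1≤i : ∀ i → i - 1ℤ ≤ i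
i-1≤i i = i≤j⇒i-k≤j 1ℤ ≤-refl

⊔₃-attained : ∀ {a b c p} → a ≤ p → b ≤ p → c ≤ p → p ≡ a ⊎ p ≡ b ⊎ p ≡ c →
              (a ⊔ b) ⊔ c ≡ p
⊔₃-attained {a} {b} {c} a≤p b≤p c≤p attained =
  ≤-antisym (⊔-lub (⊔-lub a≤p b≤p) c≤p) (p≤ attained)
  where
  p≤ : ∀ {p} → p ≡ a ⊎ p ≡ b ⊎ p ≡ c → p ≤ (a ⊔ b) ⊔ c
  p≤ (inj₁ refl)        = ≤-trans (i≤i⊔j a b) (i≤i⊔j (a ⊔ b) c)
  p≤ (inj₂ (inj₁ refl)) = ≤-trans (i≤j⊔i a b) (i≤i⊔j (a ⊔ b) c)
  p≤ (inj₂ (inj₂ refl)) = i≤j⊔i (a ⊔ b) c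

coord : Coord → Point → ℤ
coord cx = px
coord cy = py
coord cz = pz

lo hi : Coord → Box → ℤ
lo cx = xmin
lo cy = ymin
lo cz = zmin
hi cx = xmax
hi cy = ymax
hi cz = zmax

point-ext : ∀ {P Q} → (∀ c → coord c P ≡ coord c Q) → P ≡ Q
point-ext {_ , _ , _} {_ , _ , _} eq with eq cx | eq cy | eq cz
... | refl | refl | refl = refl

_≤ₚ_ : Point → Point → Set
P ≤ₚ Q = ∀ c → coord c P ≤ coord c Q

coord-origin : ∀ c → coord c origin ≡ 0ℤ
coord-origin cx = refl
coord-origin cy = refl
coord-origin cz = refl

coord-dec-self : ∀ c P → coord c (dec c P) ≡ coord c P - 1ℤ
coord-dec-self cx (_ , _ , _) = refl
coord-dec-self cy (_ , _ , _) = refl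
coord-dec-self cz (_ , _ , _) = refl

coord-dec-other : ∀ {c d} P → c ≢ d → coord d (dec c P) ≡ coord d P
coord-dec-other {cx} {cx} _ c≢d = contradiction refl c≢d
coord-dec-other {cy} {cy} _ c≢d = contradiction refl c≢d
coord-dec-other {cz} {cz} _ c≢d = contradiction refl c≢d
coord-dec-other {cx} {cy} (_ , _ , _) _ = refl
coord-dec-other {cx} {cz} (_ , _ , _) _ = refl
coord-dec-other {cy} {cx} (_ , _ , _) _ = refl
coord-dec-other {cy} {cz} (_ , _ , _) _ = refl
coord-dec-other {cz} {cx} (_ , _ , _) _ = refl
coord-dec-other {cz} {cy} (_ , _ , _) _ = refl

coord-∪ₚ : ∀ c P Q → coord c (P ∪ₚ Q) ≡ coord c P ⊔ coord c Q
coord-∪ₚ cx (_ , _ , _) (_ , _ , _) = refl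
coord-∪ₚ cy (_ , _ , _) (_ , _ , _) = refl
coord-∪ₚ cz (_ , _ , _) (_ , _ , _) = refl

∪ₚ-comm : ∀ P Q → P ∪ₚ Q ≡ Q ∪ₚ P
∪ₚ-comm (a , b , c) (a' , b' , c') =
  cong₂ _,_ (⊔-comm a a') (cong₂ _,_ (⊔-comm b b') (⊔-comm c c'))

∪ₚ₃-attained : ∀ {A₁ A₂ A₃ P} → A₁ ≤ₚ P → A₂ ≤ₚ P → A₃ ≤ₚ P →
               px A₁ ≡ px P → py A₂ ≡ py P → pz A₃ ≡ pz P → (A₁ ∪ₚ A₂) ∪ₚ A₃ ≡ P
∪ₚ₃-attained {A₁} {A₂} {A₃} {P} A₁≤P A₂≤P A₃≤P x≡ y≡ z≡ = point-ext λ c →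
  trans (coord-∪₃ c) (⊔₃-attained (A₁≤P c) (A₂≤P c) (A₃≤P c) (attained c))
  where
  coord-∪₃ : ∀ c → coord c ((A₁ ∪ₚ A₂) ∪ₚ A₃) ≡ (coord c A₁ ⊔ coord c A₂) ⊔ coord c A₃
  coord-∪₃ c = trans (coord-∪ₚ c (A₁ ∪ₚ A₂) A₃) (cong (_⊔ coord c A₃) (coord-∪ₚ c A₁ A₂))
  attained : ∀ c → coord c P ≡ coord c A₁ ⊎ coord c P ≡ coord c A₂ ⊎ coord c P ≡ coord c A₃
  attained cx = inj₁ (sym x≡)
  attained cy = inj₂ (inj₁ (sym y≡))
  attained cz = inj₂ (inj₂ (sym z≡))

corner : Box → Point
corner B = xmin B , ymin B , zmin B

coord-corner : ∀ c B → coord c (corner B) ≡ lo c B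
coord-corner cx B = refl
coord-corner cy B = refl
coord-corner cz B = refl

∈Box⇒bounds : ∀ {P B} → P ∈Box B → ∀ c → lo c B ≤ coord c P × coord c P ≤ hi c B
∈Box⇒bounds {_ , _ , _} (x , _ , _) cx = x
∈Box⇒bounds {_ , _ , _} (_ , y , _) cy = y
∈Box⇒bounds {_ , _ , _} (_ , _ , z) cz = z

bounds⇒∈Box : ∀ {P B} → (∀ c → lo c B ≤ coord c P × coord c P ≤ hi c B) → P ∈Box B
bounds⇒∈Box {_ , _ , _} bounds = bounds cx , bounds cy , bounds cz

dec-∈Box : ∀ {P B} c → P ∈Box B → lo c B < coord c P → dec c P ∈Box B
dec-∈Box {_ , _ , _} cx ((_ , h) , y , z) lo<x = (i<j⇒i≤j-1 lo<x , ≤-trans (i-1≤i _) h) , y , z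
dec-∈Box {_ , _ , _} cy (x , (_ , h) , z) lo<y = x , (i<j⇒i≤j-1 lo<y , ≤-trans (i-1≤i _) h) , z
dec-∈Box {_ , _ , _} cz (x , y , (_ , h)) lo<z = x , y , i<j⇒i≤j-1 lo<z , ≤-trans (i-1≤i _) h

dec-∉Box⇒≤lo : ∀ {P B} c → P ∈Box B → ¬ (dec c P ∈Box B) → coord c P ≤ lo c B
dec-∉Box⇒≤lo c P∈B dec∉B = ≮⇒≥ λ lo<P → dec∉B (dec-∈Box c P∈B lo<P)

∈Box⇒corner⊎descends : ∀ {P B} → P ∈Box B → P ≡ corner B ⊎ ∃[ c ] (dec c P ∈Box B)
∈Box⇒corner⊎descends {P} {B} P∈B
  with lo cx B <? coord cx P | lo cy B <? coord cy P | lo cz B <? coord cz P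
... | yes lo<x | _        | _        = inj₂ (cx , dec-∈Box cx P∈B lo<x)
... | no _     | yes lo<y | _        = inj₂ (cy , dec-∈Box cy P∈B lo<y)
... | no _     | no _     | yes lo<z = inj₂ (cz , dec-∈Box cz P∈B lo<z)
... | no x≮    | no y≮    | no z≮    = inj₁ (point-ext at-lo)
  where
  at-lo : ∀ c → coord c P ≡ coord c (corner B)
  at-lo cx = ≤-antisym (≮⇒≥ x≮) (proj₁ (∈Box⇒bounds P∈B cx))
  at-lo cy = ≤-antisym (≮⇒≥ y≮) (proj₁ (∈Box⇒bounds P∈B cy))
  at-lo cz = ≤-antisym (≮⇒≥ z≮) (proj₁ (∈Box⇒bounds P∈B cz))

module _ {C D : Box} (C→D : Consecutive C D) where

  lo-mono : ∀ c → lo c C ≤ lo c D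
  lo-mono cx = proj₁ (proj₁ (proj₁ C→D))
  lo-mono cy = proj₁ (proj₂ (proj₁ (proj₁ C→D)))
  lo-mono cz = proj₂ (proj₂ (proj₁ (proj₁ C→D)))

  lo≤hi-prev : ∀ c → lo c D ≤ hi c C
  lo≤hi-prev cx = proj₁ (proj₁ (proj₂ C→D))
  lo≤hi-prev cy = proj₁ (proj₂ (proj₁ (proj₂ C→D)))
  lo≤hi-prev cz = proj₂ (proj₂ (proj₁ (proj₂ C→D)))

  hi-mono : ∀ c → hi c C ≤ hi c D
  hi-mono cx = proj₁ (proj₁ (proj₂ (proj₂ C→D)))
  hi-mono cy = proj₁ (proj₂ (proj₁ (proj₂ (proj₂ C→D))))
  hi-mono cz = proj₂ (proj₂ (proj₁ (proj₂ (proj₂ C→D))))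

  corner-∈Box-prev : corner D ∈Box C
  corner-∈Box-prev = bounds⇒∈Box λ c →
    subst (lo c C ≤_) (sym (coord-corner c D)) (lo-mono c) ,
    subst (_≤ hi c C) (sym (coord-corner c D)) (lo≤hi-prev c)

  corner-≢-prev : corner D ≢ corner C
  corner-≢-prev D≡C with proj₂ (proj₁ C→D)
  ... | inj₁ x<        = <-irrefl (sym (cong px D≡C)) x<
  ... | inj₂ (inj₁ y<) = <-irrefl (sym (cong py D≡C)) y<
  ... | inj₂ (inj₂ z<) = <-irrefl (sym (cong pz D≡C)) z<

lo-≤-∈St : ∀ {C rest P} → Linked Consecutive (C ∷ rest) → P ∈St (C ∷ rest) →
           ∀ c → lo c C ≤ coord c P
lo-≤-∈St _ (here P∈C) c = proj₁ (∈Box⇒bounds P∈C c)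
lo-≤-∈St {rest = _ ∷ _} (C→D ∷ linked) (there P∈St) c =
  ≤-trans (lo-mono C→D c) (lo-≤-∈St linked P∈St c)

∈St⇒corner⊎descends : ∀ {C rest P} → Linked Consecutive (C ∷ rest) → P ∈St (C ∷ rest) →
                      P ≡ corner C ⊎ ∃[ c ] (dec c P ∈St (C ∷ rest))
∈St⇒corner⊎descends _ (here P∈C) with ∈Box⇒corner⊎descends P∈C
... | inj₁ P≡corner  = inj₁ P≡corner
... | inj₂ (c , dec∈C) = inj₂ (c , here dec∈C)
∈St⇒corner⊎descends {rest = _ ∷ _} (C→D ∷ linked) (there P∈St)
  with ∈St⇒corner⊎descends linked P∈St
... | inj₂ (c , dec∈St) = inj₂ (c , there dec∈St)
... | inj₁ refl with ∈Box⇒corner⊎descends (corner-∈Box-prev C→D)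
...   | inj₁ D≡C          = contradiction D≡C (corner-≢-prev C→D)
...   | inj₂ (c , dec∈C)  = inj₂ (c , here dec∈C)

∪ₚ-∈St-below : ∀ {C rest P Q} → Linked Consecutive (C ∷ rest) →
               (∀ c → coord c P ≤ hi c C) → Q ∈St (C ∷ rest) → (Q ∪ₚ P) ∈St (C ∷ rest)
∪ₚ-∈St-below {P = P} {Q} _ P≤hi (here Q∈C) = here (bounds⇒∈Box λ c →
  subst (λ m → _ ≤ m × m ≤ _) (sym (coord-∪ₚ c Q P))
    ( ≤-trans (proj₁ (∈Box⇒bounds Q∈C c)) (i≤i⊔j (coord c Q) (coord c P))
    , ⊔-lub (proj₂ (∈Box⇒bounds Q∈C c)) (P≤hi c)))
∪ₚ-∈St-below {rest = _ ∷ _} (C→D ∷ linked) P≤hi (there Q∈St) =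
  there (∪ₚ-∈St-below linked (λ c → ≤-trans (P≤hi c) (hi-mono C→D c)) Q∈St)

∪ₚ-∈St : ∀ {C rest P Q} → Linked Consecutive (C ∷ rest) →
         P ∈St (C ∷ rest) → Q ∈St (C ∷ rest) → (P ∪ₚ Q) ∈St (C ∷ rest)
∪ₚ-∈St {P = P} {Q} linked (here P∈C) Q∈St =
  subst (_∈St _) (∪ₚ-comm Q P)
    (∪ₚ-∈St-below linked (λ c → proj₂ (∈Box⇒bounds P∈C c)) Q∈St)
∪ₚ-∈St linked P∈St@(there _) (here Q∈C) =
  ∪ₚ-∈St-below linked (λ c → proj₂ (∈Box⇒bounds Q∈C c)) P∈St
∪ₚ-∈St {rest = _ ∷ _} (_ ∷ linked) (there P∈St) (there Q∈St) =
  there (∪ₚ-∈St linked P∈St Q∈St)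

record SearchOrder : Set where
  field
    u v w  : Coord
    covers : ∀ c → c ≡ u ⊎ c ≡ v ⊎ c ≡ w
    u≢w    : u ≢ w
    v≢w    : v ≢ w

order-xyz order-yzx order-zxy : SearchOrder
order-xyz = record
  { u = cx ; v = cy ; w = cz ; u≢w = λ () ; v≢w = λ ()
  ; covers = λ { cx → inj₁ refl ; cy → inj₂ (inj₁ refl) ; cz → inj₂ (inj₂ refl) } }
order-yzx = record
  { u = cy ; v = cz ; w = cx ; u≢w = λ () ; v≢w = λ ()
  ; covers = λ { cy → inj₁ refl ; cz → inj₂ (inj₁ refl) ; cx → inj₂ (inj₂ refl) } }
order-zxy = record
  { u = cz ; v = cx ; w = cy ; u≢w = λ () ; v≢w = λ ()
  ; covers = λ { cz → inj₁ refl ; cx → inj₂ (inj₁ refl) ; cy → inj₂ (inj₂ refl) } }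

module Tracing (o : SearchOrder) where
  open SearchOrder o

  Stuck : List Box → Point → Set
  Stuck Cs Q = ¬ (dec u Q ∈St Cs) × ¬ (dec v Q ∈St Cs)

  stuck-tail : ∀ {C rest Q} → Stuck (C ∷ rest) Q → Stuck rest Q
  stuck-tail (u∉ , v∉) = (λ d → u∉ (there d)) , (λ d → v∉ (there d))

  stuck-∈Box⇒≤lo : ∀ {C rest Q} → Stuck (C ∷ rest) Q → Q ∈Box C →
                   coord u Q ≤ lo u C × coord v Q ≤ lo v C
  stuck-∈Box⇒≤lo (u∉ , v∉) Q∈C =
    dec-∉Box⇒≤lo u Q∈C (λ d → u∉ (here d)) , dec-∉Box⇒≤lo v Q∈C (λ d → v∉ (here d))

  ≤ₚ-intro : ∀ {Q P} → coord u Q ≤ coord u P → coord v Q ≤ coord v P →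
             coord w Q ≡ coord w P → Q ≤ₚ P
  ≤ₚ-intro u≤ v≤ w≡ c with covers c
  ... | inj₁ refl        = u≤
  ... | inj₂ (inj₁ refl) = v≤
  ... | inj₂ (inj₂ refl) = ≤-reflexive w≡

  stuck-∈Box-head : ∀ {C rest Q} → Linked Consecutive (C ∷ rest) → Q ∈St (C ∷ rest) →
                    Stuck (C ∷ rest) Q → coord w Q ≤ hi w C → Q ∈Box C
  stuck-∈Box-head _ (here Q∈C) _ _ = Q∈C
  stuck-∈Box-head {C} {D ∷ _} {Q} (C→D ∷ linked) (there Q∈St) stuck w≤hi =
    bounds⇒∈Box λ c → ≤-trans (lo-mono C→D c) (proj₁ (∈Box⇒bounds Q∈D c)) , below c
    where
    Q∈D : Q ∈Box D
    Q∈D = stuck-∈Box-head linked Q∈St (stuck-tail stuck) (≤-trans w≤hi (hi-mono C→D w))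
    below : ∀ c → coord c Q ≤ hi c C
    below c with covers c
    ... | inj₁ refl        =
      ≤-trans (proj₁ (stuck-∈Box⇒≤lo (stuck-tail stuck) Q∈D)) (lo≤hi-prev C→D u)
    ... | inj₂ (inj₁ refl) =
      ≤-trans (proj₂ (stuck-∈Box⇒≤lo (stuck-tail stuck) Q∈D)) (lo≤hi-prev C→D v)
    ... | inj₂ (inj₂ refl) = w≤hi

  stuck-≤ₚ-slice : ∀ {C rest Q P} → Linked Consecutive (C ∷ rest) →
                   Q ∈St (C ∷ rest) → Stuck (C ∷ rest) Q →
                   P ∈St (C ∷ rest) → coord w Q ≡ coord w P → Q ≤ₚ P
  stuck-≤ₚ-slice {C} {Q = Q} linked (here Q∈C) stuck P∈St w≡ =
    ≤ₚ-intro (≤-trans (proj₁ lo-bounds) (lo-≤-∈St linked P∈St u))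
             (≤-trans (proj₂ lo-bounds) (lo-≤-∈St linked P∈St v)) w≡
    where
    lo-bounds : coord u Q ≤ lo u C × coord v Q ≤ lo v C
    lo-bounds = stuck-∈Box⇒≤lo stuck Q∈C
  stuck-≤ₚ-slice {C} {Q = Q} linked Q∈St@(there _) stuck (here P∈C) w≡ =
    ≤ₚ-intro (≤-trans (proj₁ lo-bounds) (proj₁ (∈Box⇒bounds P∈C u)))
             (≤-trans (proj₂ lo-bounds) (proj₁ (∈Box⇒bounds P∈C v))) w≡
    where
    Q∈C : Q ∈Box C
    Q∈C = stuck-∈Box-head linked Q∈St stuck
            (≤-trans (≤-reflexive w≡) (proj₂ (∈Box⇒bounds P∈C w)))
    lo-bounds : coord u Q ≤ lo u C × coord v Q ≤ lo v C
    lo-bounds = stuck-∈Box⇒≤lo stuck Q∈C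
  stuck-≤ₚ-slice {rest = _ ∷ _} (_ ∷ linked) (there Q∈St) stuck (there P∈St) w≡ =
    stuck-≤ₚ-slice linked Q∈St (stuck-tail stuck) P∈St w≡

  module _ {C rest} (linked : Linked Consecutive (C ∷ rest)) (based : corner C ≡ origin) where

    Cs : List Box
    Cs = C ∷ rest

    ∈St⇒0≤coord : ∀ {P} → P ∈St Cs → ∀ c → 0ℤ ≤ coord c P
    ∈St⇒0≤coord P∈St c =
      subst (_≤ _) (trans (sym (coord-corner c C)) (trans (cong (coord c) based) (coord-origin c)))
            (lo-≤-∈St linked P∈St c)

    origin-stuck : Stuck Cs origin
    origin-stuck = cannot-descend u , cannot-descend v
      where
      0≰-1 : ¬ (0ℤ ≤ -1ℤ)
      0≰-1 ()
      cannot-descend : ∀ c → ¬ (dec c origin ∈St Cs)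
      cannot-descend cx d = 0≰-1 (∈St⇒0≤coord d cx)
      cannot-descend cy d = 0≰-1 (∈St⇒0≤coord d cy)
      cannot-descend cz d = 0≰-1 (∈St⇒0≤coord d cz)

    step-∈St : ∀ {Q Q'} → Q ∈St Cs → Q ≢ origin → Step Cs u v w Q Q' → Q' ∈St Cs
    step-∈St _ _ (step-u d) = d
    step-∈St _ _ (step-v _ d) = d
    step-∈St Q∈St Q≢origin (step-w u∉ v∉) with ∈St⇒corner⊎descends linked Q∈St
    ... | inj₁ Q≡corner = contradiction (trans Q≡corner based) Q≢origin
    ... | inj₂ (c , d) with covers c
    ...   | inj₁ refl        = contradiction d u∉
    ...   | inj₂ (inj₁ refl) = contradiction d v∉
    ...   | inj₂ (inj₂ refl) = d

    run-⊆St : ∀ {Q L A} → Run Cs u v w Q L → Q ∈St Cs → A ∈ L → A ∈St Cs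
    run-⊆St stop Q∈St (here refl) = Q∈St
    run-⊆St (next _ _ _) Q∈St (here refl) = Q∈St
    run-⊆St (next Q≢origin step run) Q∈St (there A∈L) =
      run-⊆St run (step-∈St Q∈St Q≢origin step) A∈L

    -- w only decreases, one unit at a time and only at stuck points, so no level is skipped.
    run-meets-level : ∀ {Q L t} → Run Cs u v w Q L → Q ∈St Cs → 0ℤ ≤ t → t ≤ coord w Q →
                      ∃[ A ] (A ∈ L × A ∈St Cs × Stuck Cs A × coord w A ≡ t)
    run-meets-level {t = t} stop origin∈St 0≤t t≤0 =
      origin , here refl , origin∈St , origin-stuck ,
      trans (coord-origin w) (≤-antisym 0≤t (subst (t ≤_) (coord-origin w) t≤0))
    run-meets-level {Q} {t = t} (next _ (step-u d) run) _ 0≤t t≤w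
      with run-meets-level run d 0≤t (subst (t ≤_) (sym (coord-dec-other Q u≢w)) t≤w)
    ... | A , A∈L , rest = A , there A∈L , rest
    run-meets-level {Q} {t = t} (next _ (step-v _ d) run) _ 0≤t t≤w
      with run-meets-level run d 0≤t (subst (t ≤_) (sym (coord-dec-other Q v≢w)) t≤w)
    ... | A , A∈L , rest = A , there A∈L , rest
    run-meets-level {Q} {t = t} (next Q≢origin step@(step-w u∉ v∉) run) Q∈St 0≤t t≤w
      with t ≟ℤ coord w Q
    ... | yes t≡w = Q , here refl , Q∈St , (u∉ , v∉) , sym t≡w
    ... | no t≢w
      with run-meets-level run (step-∈St Q∈St Q≢origin step) 0≤t
             (subst (t ≤_) (sym (coord-dec-self w Q)) (i<j⇒i≤j-1 (≤∧≢⇒< t≤w t≢w)))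
    ...   | A , A∈L , rest = A , there A∈L , rest

    traced-⊆St : ∀ {P₀ H A} → Traced Cs u v w P₀ H → P₀ ∈St Cs → A ∈ H → A ∈St Cs
    traced-⊆St (_ , run , refl) P₀∈St A∈H = run-⊆St run P₀∈St (reverse⁻ A∈H)

    traced-meets-slice : ∀ {P₀ H P} → Traced Cs u v w P₀ H → MaxIn (coord w) Cs P₀ →
                         P ∈St Cs → ∃[ A ] (A ∈ H × A ≤ₚ P × coord w A ≡ coord w P)
    traced-meets-slice {P = P} (_ , run , refl) (P₀∈St , P₀-max) P∈St
      with run-meets-level run P₀∈St (∈St⇒0≤coord P∈St w) (P₀-max P P∈St)
    ... | A , A∈L , A∈St , stuck , w≡ =
      A , reverse⁺ A∈L , stuck-≤ₚ-slice linked A∈St stuck P∈St w≡ , w≡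

corner≡origin : ∀ {C} → xmin C ≡ 0ℤ × ymin C ≡ 0ℤ × zmin C ≡ 0ℤ → corner C ≡ origin
corner≡origin (x≡0 , y≡0 , z≡0) = cong₂ _,_ x≡0 (cong₂ _,_ y≡0 z≡0)

lemma7 : (C₁ : Box) (rest : List Box) → Regular C₁ rest →
         (Pz Px Py : Point) →
         MaxIn pz (C₁ ∷ rest) Pz → MaxIn px (C₁ ∷ rest) Px → MaxIn py (C₁ ∷ rest) Py →
         (Hz Hx Hy : List Point) →
         Traced (C₁ ∷ rest) cx cy cz Pz Hz →
         Traced (C₁ ∷ rest) cy cz cx Px Hx →
         Traced (C₁ ∷ rest) cz cx cy Py Hy →
         (∀ P → P ∈St (C₁ ∷ rest) → P ∈Join[ Hx , Hy , Hz ])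
         × (∀ P → P ∈Join[ Hx , Hy , Hz ] → P ∈St (C₁ ∷ rest))
lemma7 C₁ rest (_ , at-0 , linked) Pz Px Py maxZ maxX maxY Hz Hx Hy tracedZ tracedX tracedY =
  ⊆join , join⊆
  where
  open Tracing using (traced-⊆St; traced-meets-slice)
  based : corner C₁ ≡ origin
  based = corner≡origin {C₁} at-0

  ⊆join : ∀ P → P ∈St (C₁ ∷ rest) → P ∈Join[ Hx , Hy , Hz ]
  ⊆join P P∈St
    with traced-meets-slice order-yzx linked based tracedX maxX P∈St
       | traced-meets-slice order-zxy linked based tracedY maxY P∈St
       | traced-meets-slice order-xyz linked based tracedZ maxZ P∈St
  ... | A₁ , A₁∈Hx , A₁≤P , x≡ | A₂ , A₂∈Hy , A₂≤P , y≡ | A₃ , A₃∈Hz , A₃≤P , z≡ =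
    A₁ , A₂ , A₃ , A₁∈Hx , A₂∈Hy , A₃∈Hz , sym (∪ₚ₃-attained A₁≤P A₂≤P A₃≤P x≡ y≡ z≡)

  join⊆ : ∀ P → P ∈Join[ Hx , Hy , Hz ] → P ∈St (C₁ ∷ rest)
  join⊆ _ (_ , _ , _ , A₁∈Hx , A₂∈Hy , A₃∈Hz , refl) =
    ∪ₚ-∈St linked
      (∪ₚ-∈St linked (traced-⊆St order-yzx linked based tracedX (proj₁ maxX) A₁∈Hx)
                     (traced-⊆St order-zxy linked based tracedY (proj₁ maxY) A₂∈Hy))
      (traced-⊆St order-xyz linked based tracedZ (proj₁ maxZ) A₃∈Hz)
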